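{- Let $m$ be an odd positive integer and let $f:\mathbb{Z}_m\to\{\pm1,\pm \mathrm{i}\}$ be a quaternary sequence. Let $\phi:\mathbb{Z}_2\times\mathbb{Z}_m\to\{\pm1\}$ be the binary $(2,m)$-array corresponding to $f$, i.e. $\phi(0,k)=\mathrm{Re}(f(k))-\mathrm{Im}(f(k))$ and $\phi(1,k)=\mathrm{Re}(f(k))+\mathrm{Im}(f(k))$ for $k\in\mathbb{Z}_m$ (equivalently $f(k)=\frac{1-\mathrm{i}}{2}(\phi(0,k)+\mathrm{i}\phi(1,k))$). Then $f$ is an optimal quaternary sequence (OQS) if and only if $\phi$ is a generalized optimal binary array GOBA$(2,m)$ of type $(1,0)$.
   Context: $\mathrm{i}=\sqrt{ -1}$. For a map $\varphi:A\to\mathbb{C}$ on a finite abelian group $A$, its periodic autocorrelation is $R_\varphi(a)=\sum_{b\in A}\varphi(b)\overline{\varphi(a+b)}$. A quaternary sequence $f:\mathbb{Z}_m\to\{\pm1,\pm\mathrm{i}\}$ of odd length $m$ is an OQS if $|R_f(w)|=1$ for all $1\le w\le m-1$. For a binary array $\phi:\mathbb{Z}_2\times\mathbb{Z}_m\to\{\pm1\}$, its expansion with respect to type $(1,0)$ is the map $\phi':E\to\{\pm1\}$, $E=\mathbb{Z}_4\times\mathbb{Z}_m$, given by $\phi'(a,k)=\phi(a,k)$ for $a\in\{0,1\}$ and $\phi'(a,k)=-\phi(a-2,k)$ for $a\in\{2,3\}$. Let $H=\{(0,0),(2,0)\}\subseteq E$. $\phi$ is a GOBA$(2,m)$ of type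 $(1,0)$ if $R_{\phi'}(x)\in\{0,\pm4\}$ for all $x\in E\setminus H$, and the number of $x\in E$ with $R_{\phi'}(x)=0$ equals $|E|/2=2m$. -}

module Defs where

open import Data.Nat as ℕ using (ℕ; zero; suc; NonZero)
open import Data.Nat.DivMod using (_mod_)
open import Data.Fin using (Fin; zero; suc; toℕ)
open import Data.Integer as ℤ using (ℤ; +_; -_; _+_; _*_; _-_)
open import Data.Product using (_×_; _,_)
open import Data.Sum using (_⊎_)
open import Relation.Binary.PropositionalEquality using (_≡_)
open import Relation.Nullary using (¬_; does)
open import Data.Bool using (if_then_else_)

infixl 6 _⊕_
_⊕_ : ∀ {k} → Fin (suc k) → Fin (suc k) → Fin (suc k)
_⊕_ {k} a b = (toℕ a ℕ.+ toℕ b) mod (suc k)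

∑ : (n : ℕ) → (Fin n → ℤ) → ℤ
∑ zero    g = + 0
∑ (suc n) g = g zero + ∑ n (λ i → g (suc i))

count : (n : ℕ) → (Fin n → ℤ) → ℕ
count zero    g = 0
count (suc n) g = (if does (g zero ℤ.≟ + 0) then 1 else 0) ℕ.+ count n (λ i → g (suc i))

infix 4 _+i_
record ℤ[i] : Set where
  constructor _+i_
  field
    re : ℤ
    im : ℤ
open ℤ[i] public

_+ᴳ_ : ℤ[i] → ℤ[i] → ℤ[i]
(a +i b) +ᴳ (c +i d) = (a + c) +i (b + d)

_*ᴳ_ : ℤ[i] → ℤ[i] → ℤ[i]
(a +i b) *ᴳ (c +i d) = (a * c - b * d) +i (a * d + b * c)

conj : ℤ[i] → ℤ[i]
conj (a +i b) = a +i (- b)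

normSq : ℤ[i] → ℤ
normSq (a +i b) = a * a + b * b

∑ᴳ : (n : ℕ) → (Fin n → ℤ[i]) → ℤ[i]
∑ᴳ zero    g = + 0 +i + 0
∑ᴳ (suc n) g = g zero +ᴳ ∑ᴳ n (λ i → g (suc i))

data Quat : Set where
  q1 q-1 qi q-i : Quat

toℤ[i] : Quat → ℤ[i]
toℤ[i] q1  = + 1 +i + 0
toℤ[i] q-1 = ℤ.-1ℤ +i + 0
toℤ[i] qi  = + 0 +i + 1
toℤ[i] q-i = + 0 +i ℤ.-1ℤ

Rf : ∀ {k} → (Fin (suc k) → Quat) → Fin (suc k) → ℤ[i]
Rf {k} f w = ∑ᴳ (suc k) (λ b → toℤ[i] (f b) *ᴳ conj (toℤ[i] (f (w ⊕ b))))

OQS : ∀ {k} → (Fin (suc k) → Quat) → Set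
OQS {k} f = ∀ (w : Fin (suc k)) → ¬ (w ≡ zero) → normSq (Rf f w) ≡ + 1

-- Binary (2,m)-arrays, φ : ℤ_2 × ℤ_m → {±1} (values as integers ±1)

BinArray : ℕ → Set
BinArray m = Fin 2 → Fin m → ℤ

arrayOf : ∀ {m} → (Fin m → Quat) → BinArray m
arrayOf f zero    k = re (toℤ[i] (f k)) - im (toℤ[i] (f k))
arrayOf f (suc _) k = re (toℤ[i] (f k)) + im (toℤ[i] (f k))

-- expansion with respect to type (1,0): φ' : ℤ_4 × ℤ_m → {±1}
expand : ∀ {m} → BinArray m → Fin 4 → Fin m → ℤ
expand φ zero                      k = φ zero k
expand φ (suc zero)                k = φ (suc zero) k
expand φ (suc (suc zero))          k = - φ zero k
expand φ (suc (suc (suc zero)))    k = - φ (suc zero) k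

Rexp : ∀ {k} → BinArray (suc k) → Fin 4 → Fin (suc k) → ℤ
Rexp {k} φ a x = ∑ 4 (λ b → ∑ (suc k) (λ c →
  expand φ b c * expand φ (a ⊕ b) (x ⊕ c)))

countE : ∀ {k} → (Fin 4 → Fin (suc k) → ℤ) → ℕ
countE {k} g = count (suc k) (g zero) ℕ.+ count (suc k) (g (suc zero))
  ℕ.+ count (suc k) (g (suc (suc zero))) ℕ.+ count (suc k) (g (suc (suc (suc zero))))

inH : ∀ {k} → Fin 4 → Fin (suc k) → Set
inH a x = (a ≡ zero ⊎ a ≡ suc (suc zero)) × x ≡ zero

GOBA : ∀ {k} → BinArray (suc k) → Set
GOBA {k} φ =
  (∀ (a : Fin 4) (x : Fin (suc k)) → ¬ inH a x →
     Rexp φ a x ≡ + 0 ⊎ Rexp φ a x ≡ + 4 ⊎ Rexp φ a x ≡ - + 4)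
  × countE (λ a x → Rexp φ a x) ≡ 2 ℕ.* suc k

-- Pairing the rows of the expansion φ' column by column turns its correlation into the
-- Gaussian-integer correlation of f: R_φ'(a, x) = 4 Re(i^a R_f(x)).  Hence R_φ' takes values
-- in {0, ±4} off H exactly when, for x ≠ 0, both coordinates of R_f(x) lie in {0, ±1}, and its
-- zeros are counted by the zero coordinates of R_f.  If f is an OQS, each R_f(x) with x ≠ 0 is
-- one of ±1, ±i and so has exactly one zero coordinate, as does R_f(0) = m; this gives 2m zeros.
-- Conversely Re R_f(x) + Im R_f(x) is a sum of m signs, hence odd because m is odd, so two
-- coordinates in {0, ±1} cannot both vanish or both be nonzero, and R_f(x) is a unit.

module Submission where

open import Defs
open import Data.Nat using (ℕ; suc; _*_)
open import Data.Fin using (Fin)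
open import Function.Bundles using (_⇔_)

open import Data.Bool using (if_then_else_)
open import Data.Empty using (⊥-elim)
open import Data.Fin using (zero; suc; toℕ)
import Data.Fin.Properties as Fin
open import Data.Integer as ℤ using (ℤ; +_; -[1+_]; -_; _+_; _-_)
import Data.Integer.Properties as ℤ
open import Data.Integer.Tactic.RingSolver using (solve-∀)
open import Data.Nat as ℕ using (zero)
open import Data.Nat.DivMod using (m<n⇒m%n≡m)
import Data.Nat.Properties as ℕ
import Data.Nat.Tactic.RingSolver as ℕ-Solver
open import Data.Product using (_,_; proj₂; ∃-syntax)
open import Data.Sum using (_⊎_; inj₁; inj₂)
open import Function.Base using (_∘_)
open import Function.Bundles using (mk⇔)
open import Relation.Binary.PropositionalEquality
open import Relation.Nullary using (¬_; does)
open ≡-Reasoning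

open import Algebra.Properties.CommutativeSemigroup ℤ.+-commutativeSemigroup
  using () renaming (interchange to +-interchange)
open import Algebra.Properties.CommutativeSemigroup ℕ.+-commutativeSemigroup
  using () renaming (interchange to ℕ-+-interchange)

∑-cong : ∀ n {g h : Fin n → ℤ} → (∀ i → g i ≡ h i) → ∑ n g ≡ ∑ n h
∑-cong zero    g≡h = refl
∑-cong (suc n) g≡h = cong₂ _+_ (g≡h zero) (∑-cong n (g≡h ∘ suc))

∑-zero : ∀ n → ∑ n (λ _ → + 0) ≡ + 0
∑-zero zero    = refl
∑-zero (suc n) = trans (ℤ.+-identityˡ _) (∑-zero n)

∑-distrib-+ : ∀ n (g h : Fin n → ℤ) → ∑ n (λ i → g i + h i) ≡ ∑ n g + ∑ n h
∑-distrib-+ zero    g h = refl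
∑-distrib-+ (suc n) g h = begin
  (g zero + h zero) + ∑ n (λ i → g (suc i) + h (suc i))
    ≡⟨ cong (_+_ (g zero + h zero)) (∑-distrib-+ n (g ∘ suc) (h ∘ suc)) ⟩
  (g zero + h zero) + (∑ n (g ∘ suc) + ∑ n (h ∘ suc))
    ≡⟨ +-interchange (g zero) (h zero) _ _ ⟩
  (g zero + ∑ n (g ∘ suc)) + (h zero + ∑ n (h ∘ suc)) ∎

*-distribˡ-∑ : ∀ n c (g : Fin n → ℤ) → c ℤ.* ∑ n g ≡ ∑ n (λ i → c ℤ.* g i)
*-distribˡ-∑ zero    c g = ℤ.*-zeroʳ c
*-distribˡ-∑ (suc n) c g =
  trans (ℤ.*-distribˡ-+ c (g zero) _) (cong (_+_ (c ℤ.* g zero)) (*-distribˡ-∑ n c (g ∘ suc)))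

∑-comm : ∀ m n (g : Fin m → Fin n → ℤ) → ∑ m (λ i → ∑ n (g i)) ≡ ∑ n (λ j → ∑ m (λ i → g i j))
∑-comm zero    n g = sym (∑-zero n)
∑-comm (suc m) n g = begin
  ∑ n (g zero) + ∑ m (λ i → ∑ n (g (suc i)))
    ≡⟨ cong (_+_ (∑ n (g zero))) (∑-comm m n (g ∘ suc)) ⟩
  ∑ n (g zero) + ∑ n (λ j → ∑ m (λ i → g (suc i) j))
    ≡⟨ ∑-distrib-+ n (g zero) _ ⟨
  ∑ n (λ j → g zero j + ∑ m (λ i → g (suc i) j)) ∎

∑ᴳ-homomorphism : (h : ℤ[i] → ℤ) → h (+ 0 +i + 0) ≡ + 0 → (∀ z w → h (z +ᴳ w) ≡ h z + h w) →
                  ∀ n (g : Fin n → ℤ[i]) → h (∑ᴳ n g) ≡ ∑ n (h ∘ g)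
∑ᴳ-homomorphism h h-0 h-+ zero    g = h-0
∑ᴳ-homomorphism h h-0 h-+ (suc n) g =
  trans (h-+ (g zero) _) (cong (_+_ (h (g zero))) (∑ᴳ-homomorphism h h-0 h-+ n (g ∘ suc)))

∑ᴳ-one : ∀ n → ∑ᴳ n (λ _ → + 1 +i + 0) ≡ (+ n +i + 0)
∑ᴳ-one zero    = refl
∑ᴳ-one (suc n) = cong ((+ 1 +i + 0) +ᴳ_) (∑ᴳ-one n)

∑ᴳ-cong : ∀ n {g h : Fin n → ℤ[i]} → (∀ i → g i ≡ h i) → ∑ᴳ n g ≡ ∑ᴳ n h
∑ᴳ-cong zero    g≡h = refl
∑ᴳ-cong (suc n) g≡h = cong₂ _+ᴳ_ (g≡h zero) (∑ᴳ-cong n (g≡h ∘ suc))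

zero-⊕ : ∀ {k} (b : Fin (suc k)) → zero ⊕ b ≡ b
zero-⊕ {k} b = trans (Fin.fromℕ<-cong _ (toℕ b) (m<n⇒m%n≡m (Fin.toℕ<n b)) _ (Fin.toℕ<n b))
                     (Fin.fromℕ<-toℕ b (Fin.toℕ<n b))

-- reRot a z is the real part of i^a z.
reRot : Fin 4 → ℤ[i] → ℤ
reRot zero                   z = re z
reRot (suc zero)             z = - im z
reRot (suc (suc zero))       z = - re z
reRot (suc (suc (suc zero))) z = im z

reRot-+ᴳ : ∀ a z w → reRot a (z +ᴳ w) ≡ reRot a z + reRot a w
reRot-+ᴳ zero                   z w = refl
reRot-+ᴳ (suc zero)             z w = ℤ.neg-distrib-+ (im z) (im w)
reRot-+ᴳ (suc (suc zero))       z w = ℤ.neg-distrib-+ (re z) (re w)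
reRot-+ᴳ (suc (suc (suc zero))) z w = refl

reRot-0ᴳ : ∀ a → reRot a (+ 0 +i + 0) ≡ + 0
reRot-0ᴳ zero                   = refl
reRot-0ᴳ (suc zero)             = refl
reRot-0ᴳ (suc (suc zero))       = refl
reRot-0ᴳ (suc (suc (suc zero))) = refl

reRot-∑ᴳ : ∀ a n (g : Fin n → ℤ[i]) → reRot a (∑ᴳ n g) ≡ ∑ n (reRot a ∘ g)
reRot-∑ᴳ a = ∑ᴳ-homomorphism (reRot a) (reRot-0ᴳ a) (reRot-+ᴳ a)

-- The column φ'(·, k) of the expansion of φ = arrayOf f, as a function of f(k).
column : ℤ[i] → Fin 4 → ℤ
column z zero                   = re z - im z
column z (suc zero)             = re z + im z
column z (suc (suc zero))       = - (re z - im z)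
column z (suc (suc (suc zero))) = - (re z + im z)

expand-arrayOf : ∀ {m} (f : Fin m → Quat) b k → expand (arrayOf f) b k ≡ column (toℤ[i] (f k)) b
expand-arrayOf f zero                   k = refl
expand-arrayOf f (suc zero)             k = refl
expand-arrayOf f (suc (suc zero))       k = refl
expand-arrayOf f (suc (suc (suc zero))) k = refl

column-correlation : ∀ a u v → ∑ 4 (λ b → column u b ℤ.* column v (a ⊕ b)) ≡ + 4 ℤ.* reRot a (u *ᴳ conj v)
-- Each rowₐ is the claim with ∑, column, _⊕_ and _*ᴳ_ unfolded, since the ring solver does not normalise.
column-correlation zero                   (x +i y) (p +i q) = row₀ x y p q
  where
  row₀ : ∀ x y p q →
    (x - y) ℤ.* (p - q) + ((x + y) ℤ.* (p + q) + (- (x - y) ℤ.* - (p - q) + (- (x + y) ℤ.* - (p + q) + + 0)))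
      ≡ + 4 ℤ.* (x ℤ.* p - y ℤ.* - q)
  row₀ = solve-∀
column-correlation (suc zero)             (x +i y) (p +i q) = row₁ x y p q
  where
  row₁ : ∀ x y p q →
    (x - y) ℤ.* (p + q) + ((x + y) ℤ.* - (p - q) + (- (x - y) ℤ.* - (p + q) + (- (x + y) ℤ.* (p - q) + + 0)))
      ≡ + 4 ℤ.* - (x ℤ.* - q + y ℤ.* p)
  row₁ = solve-∀
column-correlation (suc (suc zero))       (x +i y) (p +i q) = row₂ x y p q
  where
  row₂ : ∀ x y p q →
    (x - y) ℤ.* - (p - q) + ((x + y) ℤ.* - (p + q) + (- (x - y) ℤ.* (p - q) + (- (x + y) ℤ.* (p + q) + + 0)))
      ≡ + 4 ℤ.* - (x ℤ.* p - y ℤ.* - q)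
  row₂ = solve-∀
column-correlation (suc (suc (suc zero))) (x +i y) (p +i q) = row₃ x y p q
  where
  row₃ : ∀ x y p q →
    (x - y) ℤ.* - (p + q) + ((x + y) ℤ.* (p - q) + (- (x - y) ℤ.* (p + q) + (- (x + y) ℤ.* - (p - q) + + 0)))
      ≡ + 4 ℤ.* (x ℤ.* - q + y ℤ.* p)
  row₃ = solve-∀

data IsUnit : ℤ[i] → Set where
  +1ᵘ : IsUnit (+ 1 +i + 0)
  -1ᵘ : IsUnit (-[1+ 0 ] +i + 0)
  +iᵘ : IsUnit (+ 0 +i + 1)
  -iᵘ : IsUnit (+ 0 +i -[1+ 0 ])

data IsSign : ℤ → Set where
  +1ˢ : IsSign (+ 1)
  -1ˢ : IsSign -[1+ 0 ]

data Ternary : ℤ → Set where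
  0ᵗ  : Ternary (+ 0)
  +1ᵗ : Ternary (+ 1)
  -1ᵗ : Ternary -[1+ 0 ]

toℤ[i]-isUnit : ∀ q → IsUnit (toℤ[i] q)
toℤ[i]-isUnit q1  = +1ᵘ
toℤ[i]-isUnit q-1 = -1ᵘ
toℤ[i]-isUnit qi  = +iᵘ
toℤ[i]-isUnit q-i = -iᵘ

conj-isUnit : ∀ {z} → IsUnit z → IsUnit (conj z)
conj-isUnit +1ᵘ = +1ᵘ
conj-isUnit -1ᵘ = -1ᵘ
conj-isUnit +iᵘ = -iᵘ
conj-isUnit -iᵘ = +iᵘ

*ᴳ-isUnit : ∀ {z w} → IsUnit z → IsUnit w → IsUnit (z *ᴳ w)
*ᴳ-isUnit +1ᵘ +1ᵘ = +1ᵘ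
*ᴳ-isUnit +1ᵘ -1ᵘ = -1ᵘ
*ᴳ-isUnit +1ᵘ +iᵘ = +iᵘ
*ᴳ-isUnit +1ᵘ -iᵘ = -iᵘ
*ᴳ-isUnit -1ᵘ +1ᵘ = -1ᵘ
*ᴳ-isUnit -1ᵘ -1ᵘ = +1ᵘ
*ᴳ-isUnit -1ᵘ +iᵘ = -iᵘ
*ᴳ-isUnit -1ᵘ -iᵘ = +iᵘ
*ᴳ-isUnit +iᵘ +1ᵘ = +iᵘ
*ᴳ-isUnit +iᵘ -1ᵘ = -iᵘ
*ᴳ-isUnit +iᵘ +iᵘ = -1ᵘ
*ᴳ-isUnit +iᵘ -iᵘ = +1ᵘ
*ᴳ-isUnit -iᵘ +1ᵘ = -iᵘ
*ᴳ-isUnit -iᵘ -1ᵘ = +iᵘ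
*ᴳ-isUnit -iᵘ +iᵘ = +1ᵘ
*ᴳ-isUnit -iᵘ -iᵘ = -1ᵘ

isUnit⇒*ᴳ-conj≡1 : ∀ {z} → IsUnit z → z *ᴳ conj z ≡ (+ 1 +i + 0)
isUnit⇒*ᴳ-conj≡1 +1ᵘ = refl
isUnit⇒*ᴳ-conj≡1 -1ᵘ = refl
isUnit⇒*ᴳ-conj≡1 +iᵘ = refl
isUnit⇒*ᴳ-conj≡1 -iᵘ = refl

isUnit⇒re+im-isSign : ∀ {z} → IsUnit z → IsSign (re z + im z)
isUnit⇒re+im-isSign +1ᵘ = +1ˢ
isUnit⇒re+im-isSign -1ᵘ = -1ˢ
isUnit⇒re+im-isSign +iᵘ = +1ˢ
isUnit⇒re+im-isSign -iᵘ = -1ˢ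

isUnit⇒normSq≡1 : ∀ {z} → IsUnit z → normSq z ≡ + 1
isUnit⇒normSq≡1 +1ᵘ = refl
isUnit⇒normSq≡1 -1ᵘ = refl
isUnit⇒normSq≡1 +iᵘ = refl
isUnit⇒normSq≡1 -iᵘ = refl

normSq≡1⇒isUnit : ∀ a b → normSq (a +i b) ≡ + 1 → IsUnit (a +i b)
normSq≡1⇒isUnit (+ 0)          (+ 0)          ()
normSq≡1⇒isUnit (+ 0)          (+ 1)          _ = +iᵘ
normSq≡1⇒isUnit (+ 0)          (+ suc (suc _)) ()
normSq≡1⇒isUnit (+ 0)          -[1+ 0 ]       _ = -iᵘ
normSq≡1⇒isUnit (+ 0)          -[1+ suc _ ]   ()
normSq≡1⇒isUnit (+ 1)          (+ 0)          _ = +1ᵘ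
normSq≡1⇒isUnit (+ 1)          (+ suc _)      ()
normSq≡1⇒isUnit (+ 1)          -[1+ _ ]       ()
normSq≡1⇒isUnit (+ suc (suc _)) (+ 0)          ()
normSq≡1⇒isUnit (+ suc (suc _)) (+ suc _)      ()
normSq≡1⇒isUnit (+ suc (suc _)) -[1+ _ ]       ()
normSq≡1⇒isUnit -[1+ 0 ]       (+ 0)          _ = -1ᵘ
normSq≡1⇒isUnit -[1+ 0 ]       (+ suc _)      ()
normSq≡1⇒isUnit -[1+ 0 ]       -[1+ _ ]       ()
normSq≡1⇒isUnit -[1+ suc _ ]   (+ 0)          ()
normSq≡1⇒isUnit -[1+ suc _ ]   (+ suc _)      ()
normSq≡1⇒isUnit -[1+ suc _ ]   -[1+ _ ]       ()

isUnit⇒ternary-re : ∀ {z} → IsUnit z → Ternary (re z)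
isUnit⇒ternary-re +1ᵘ = +1ᵗ
isUnit⇒ternary-re -1ᵘ = -1ᵗ
isUnit⇒ternary-re +iᵘ = 0ᵗ
isUnit⇒ternary-re -iᵘ = 0ᵗ

isUnit⇒ternary-im : ∀ {z} → IsUnit z → Ternary (im z)
isUnit⇒ternary-im +1ᵘ = 0ᵗ
isUnit⇒ternary-im -1ᵘ = 0ᵗ
isUnit⇒ternary-im +iᵘ = +1ᵗ
isUnit⇒ternary-im -iᵘ = -1ᵗ

ternary-neg : ∀ {z} → Ternary z → Ternary (- z)
ternary-neg 0ᵗ  = 0ᵗ
ternary-neg +1ᵗ = -1ᵗ
ternary-neg -1ᵗ = +1ᵗ

ternary-reRot : ∀ {z} → Ternary (re z) → Ternary (im z) → ∀ a → Ternary (reRot a z)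
ternary-reRot t-re t-im zero                   = t-re
ternary-reRot t-re t-im (suc zero)             = ternary-neg t-im
ternary-reRot t-re t-im (suc (suc zero))       = ternary-neg t-re
ternary-reRot t-re t-im (suc (suc (suc zero))) = t-im

Is0or±4 : ℤ → Set
Is0or±4 v = v ≡ + 0 ⊎ v ≡ + 4 ⊎ v ≡ - + 4

ternary⇒4*-is0or±4 : ∀ {z} → Ternary z → Is0or±4 (+ 4 ℤ.* z)
ternary⇒4*-is0or±4 0ᵗ  = inj₁ refl
ternary⇒4*-is0or±4 +1ᵗ = inj₂ (inj₁ refl)
ternary⇒4*-is0or±4 -1ᵗ = inj₂ (inj₂ refl)

4*-is0or±4⇒ternary : ∀ z → Is0or±4 (+ 4 ℤ.* z) → Ternary z
4*-is0or±4⇒ternary z (inj₁ 4z≡0)        = subst Ternary (sym (ℤ.*-cancelˡ-≡ (+ 4) z (+ 0) 4z≡0)) 0ᵗ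
4*-is0or±4⇒ternary z (inj₂ (inj₁ 4z≡4)) = subst Ternary (sym (ℤ.*-cancelˡ-≡ (+ 4) z (+ 1) 4z≡4)) +1ᵗ
4*-is0or±4⇒ternary z (inj₂ (inj₂ 4z≡-4)) = subst Ternary (sym (ℤ.*-cancelˡ-≡ (+ 4) z (- + 1) 4z≡-4)) -1ᵗ

Odd : ℤ → Set
Odd z = ∃[ j ] z ≡ + 1 + + 2 ℤ.* j

even⇒¬odd : ∀ c → ¬ Odd (+ 2 ℤ.* c)
even⇒¬odd c (j , 2c≡1+2j) =
  2≢1 (ℕ.m*n≡1⇒m≡1 2 ℤ.∣ c - j ∣ (trans (sym (ℤ.abs-* (+ 2) (c - j))) (cong ℤ.∣_∣ 2[c-j]≡1)))
  where
  2≢1 : 2 ≢ 1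
  2≢1 ()
  distrib : ∀ c j → + 2 ℤ.* (c - j) ≡ + 2 ℤ.* c - + 2 ℤ.* j
  distrib = solve-∀
  cancel : ∀ j → + 1 + + 2 ℤ.* j - + 2 ℤ.* j ≡ + 1
  cancel = solve-∀
  2[c-j]≡1 : + 2 ℤ.* (c - j) ≡ + 1
  2[c-j]≡1 = begin
    + 2 ℤ.* (c - j)               ≡⟨ distrib c j ⟩
    + 2 ℤ.* c - + 2 ℤ.* j         ≡⟨ cong (_- + 2 ℤ.* j) 2c≡1+2j ⟩
    + 1 + + 2 ℤ.* j - + 2 ℤ.* j   ≡⟨ cancel j ⟩
    + 1                           ∎

∑-isSign-parity : ∀ n (g : Fin n → ℤ) → (∀ i → IsSign (g i)) → ∃[ j ] ∑ n g ≡ + n + + 2 ℤ.* j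
∑-isSign-parity zero    g sign = + 0 , refl
∑-isSign-parity (suc n) g sign with g zero | sign zero | ∑-isSign-parity n (g ∘ suc) (sign ∘ suc)
... | _ | +1ˢ | j , ∑≡ = j , trans (cong (_+_ (+ 1)) ∑≡) (plusOne (+ n) j)
  where
  plusOne : ∀ n j → + 1 + (n + + 2 ℤ.* j) ≡ (+ 1 + n) + + 2 ℤ.* j
  plusOne = solve-∀
... | _ | -1ˢ | j , ∑≡ = j - + 1 , trans (cong (_+_ (- + 1)) ∑≡) (minusOne (+ n) j)
  where
  minusOne : ∀ n j → - + 1 + (n + + 2 ℤ.* j) ≡ (+ 1 + n) + + 2 ℤ.* (j - + 1)
  minusOne = solve-∀

∑-odd-isSign-odd : ∀ n (g : Fin (suc (2 * n)) → ℤ) → (∀ i → IsSign (g i)) → Odd (∑ (suc (2 * n)) g)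
∑-odd-isSign-odd n g sign with ∑-isSign-parity (suc (2 * n)) g sign
... | j , ∑≡ = + n + j , trans ∑≡ (trans (cong (λ t → + 1 + t + + 2 ℤ.* j) (ℤ.pos-* 2 n)) (regroup (+ n) j))
  where
  regroup : ∀ n j → + 1 + + 2 ℤ.* n + + 2 ℤ.* j ≡ + 1 + + 2 ℤ.* (n + j)
  regroup = solve-∀

ternary-odd⇒isUnit : ∀ {a b} → Ternary a → Ternary b → Odd (a + b) → IsUnit (a +i b)
ternary-odd⇒isUnit 0ᵗ  0ᵗ  odd = ⊥-elim (even⇒¬odd (+ 0) odd)
ternary-odd⇒isUnit 0ᵗ  +1ᵗ _   = +iᵘ
ternary-odd⇒isUnit 0ᵗ  -1ᵗ _   = -iᵘ
ternary-odd⇒isUnit +1ᵗ 0ᵗ  _   = +1ᵘ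
ternary-odd⇒isUnit +1ᵗ +1ᵗ odd = ⊥-elim (even⇒¬odd (+ 1) odd)
ternary-odd⇒isUnit +1ᵗ -1ᵗ odd = ⊥-elim (even⇒¬odd (+ 0) odd)
ternary-odd⇒isUnit -1ᵗ 0ᵗ  _   = -1ᵘ
ternary-odd⇒isUnit -1ᵗ +1ᵗ odd = ⊥-elim (even⇒¬odd (+ 0) odd)
ternary-odd⇒isUnit -1ᵗ -1ᵗ odd = ⊥-elim (even⇒¬odd (- + 1) odd)

δ₀ : ℤ → ℕ
δ₀ z = if does (z ℤ.≟ + 0) then 1 else 0

δ₀-neg : ∀ z → δ₀ (- z) ≡ δ₀ z
δ₀-neg (+ 0)     = refl
δ₀-neg (+ suc n) = refl
δ₀-neg -[1+ n ]  = refl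

δ₀-4* : ∀ z → δ₀ (+ 4 ℤ.* z) ≡ δ₀ z
δ₀-4* (+ 0)     = refl
δ₀-4* (+ suc n) = refl
δ₀-4* -[1+ n ]  = refl

isUnit⇒δ₀-re+δ₀-im≡1 : ∀ {z} → IsUnit z → δ₀ (re z) ℕ.+ δ₀ (im z) ≡ 1
isUnit⇒δ₀-re+δ₀-im≡1 +1ᵘ = refl
isUnit⇒δ₀-re+δ₀-im≡1 -1ᵘ = refl
isUnit⇒δ₀-re+δ₀-im≡1 +iᵘ = refl
isUnit⇒δ₀-re+δ₀-im≡1 -iᵘ = refl

count-cong : ∀ n (g h : Fin n → ℤ) → (∀ i → δ₀ (g i) ≡ δ₀ (h i)) → count n g ≡ count n h
count-cong zero    g h δ₀g≡δ₀h = refl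
count-cong (suc n) g h δ₀g≡δ₀h =
  cong₂ ℕ._+_ (δ₀g≡δ₀h zero) (count-cong n (g ∘ suc) (h ∘ suc) (δ₀g≡δ₀h ∘ suc))

count-complementary : ∀ n (g h : Fin n → ℤ) → (∀ i → δ₀ (g i) ℕ.+ δ₀ (h i) ≡ 1) →
                      count n g ℕ.+ count n h ≡ n
count-complementary zero    g h one = refl
count-complementary (suc n) g h one = begin
  (δ₀ (g zero) ℕ.+ count n (g ∘ suc)) ℕ.+ (δ₀ (h zero) ℕ.+ count n (h ∘ suc))
    ≡⟨ ℕ-+-interchange (δ₀ (g zero)) (count n (g ∘ suc)) _ _ ⟩
  (δ₀ (g zero) ℕ.+ δ₀ (h zero)) ℕ.+ (count n (g ∘ suc) ℕ.+ count n (h ∘ suc))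
    ≡⟨ cong₂ ℕ._+_ (one zero) (count-complementary n (g ∘ suc) (h ∘ suc) (one ∘ suc)) ⟩
  suc n ∎

module _ {k} (f : Fin (suc k) → Quat) where

  private
    m : ℕ
    m = suc k

    F : Fin m → ℤ[i]
    F = toℤ[i] ∘ f

    term : Fin m → Fin m → ℤ[i]
    term x c = F c *ᴳ conj (F (x ⊕ c))

  Rexp-arrayOf : ∀ a x → Rexp (arrayOf f) a x ≡ + 4 ℤ.* reRot a (Rf f x)
  Rexp-arrayOf a x = begin
    Rexp (arrayOf f) a x
      ≡⟨ ∑-comm 4 m (λ b c → expand (arrayOf f) b c ℤ.* expand (arrayOf f) (a ⊕ b) (x ⊕ c)) ⟩
    ∑ m (λ c → ∑ 4 (λ b → expand (arrayOf f) b c ℤ.* expand (arrayOf f) (a ⊕ b) (x ⊕ c)))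
      ≡⟨ ∑-cong m (λ c → ∑-cong 4 (λ b →
           cong₂ ℤ._*_ (expand-arrayOf f b c) (expand-arrayOf f (a ⊕ b) (x ⊕ c)))) ⟩
    ∑ m (λ c → ∑ 4 (λ b → column (F c) b ℤ.* column (F (x ⊕ c)) (a ⊕ b)))
      ≡⟨ ∑-cong m (λ c → column-correlation a (F c) (F (x ⊕ c))) ⟩
    ∑ m (λ c → + 4 ℤ.* reRot a (term x c))
      ≡⟨ *-distribˡ-∑ m (+ 4) (reRot a ∘ term x) ⟨
    + 4 ℤ.* ∑ m (reRot a ∘ term x)
      ≡⟨ cong (ℤ._*_ (+ 4)) (reRot-∑ᴳ a m (term x)) ⟨
    + 4 ℤ.* reRot a (Rf f x) ∎

  Rf-zero : Rf f zero ≡ (+ m +i + 0)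
  Rf-zero = trans (∑ᴳ-cong m term-zero) (∑ᴳ-one m)
    where
    term-zero : ∀ c → term zero c ≡ (+ 1 +i + 0)
    term-zero c rewrite zero-⊕ c = isUnit⇒*ᴳ-conj≡1 (toℤ[i]-isUnit (f c))

  re+im-Rf : ∀ x → re (Rf f x) + im (Rf f x) ≡ ∑ m (λ c → re (term x c) + im (term x c))
  re+im-Rf x = ∑ᴳ-homomorphism (λ z → re z + im z) refl (λ z w → +-interchange (re z) (re w) (im z) (im w)) m (term x)

  re+im-term-isSign : ∀ x c → IsSign (re (term x c) + im (term x c))
  re+im-term-isSign x c =
    isUnit⇒re+im-isSign (*ᴳ-isUnit (toℤ[i]-isUnit (f c)) (conj-isUnit (toℤ[i]-isUnit (f (x ⊕ c)))))

  countE-Rexp-arrayOf : countE (Rexp (arrayOf f)) ≡ 2 * (count m (re ∘ Rf f) ℕ.+ count m (im ∘ Rf f))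
  countE-Rexp-arrayOf =
    trans (cong₂ ℕ._+_ (cong₂ ℕ._+_ (cong₂ ℕ._+_ row₀ row₁) row₂) row₃)
          (regroup (count m (re ∘ Rf f)) (count m (im ∘ Rf f)))
    where
    δ₀-Rexp : ∀ a x → δ₀ (Rexp (arrayOf f) a x) ≡ δ₀ (reRot a (Rf f x))
    δ₀-Rexp a x = trans (cong δ₀ (Rexp-arrayOf a x)) (δ₀-4* (reRot a (Rf f x)))
    row₀ : count m (Rexp (arrayOf f) zero) ≡ count m (re ∘ Rf f)
    row₀ = count-cong m (Rexp (arrayOf f) zero) (re ∘ Rf f) (δ₀-Rexp zero)
    row₁ : count m (Rexp (arrayOf f) (suc zero)) ≡ count m (im ∘ Rf f)
    row₁ = count-cong m (Rexp (arrayOf f) (suc zero)) (im ∘ Rf f)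
             (λ x → trans (δ₀-Rexp (suc zero) x) (δ₀-neg (im (Rf f x))))
    row₂ : count m (Rexp (arrayOf f) (suc (suc zero))) ≡ count m (re ∘ Rf f)
    row₂ = count-cong m (Rexp (arrayOf f) (suc (suc zero))) (re ∘ Rf f)
             (λ x → trans (δ₀-Rexp (suc (suc zero)) x) (δ₀-neg (re (Rf f x))))
    row₃ : count m (Rexp (arrayOf f) (suc (suc (suc zero)))) ≡ count m (im ∘ Rf f)
    row₃ = count-cong m (Rexp (arrayOf f) (suc (suc (suc zero)))) (im ∘ Rf f) (δ₀-Rexp (suc (suc (suc zero))))
    regroup : ∀ a b → a ℕ.+ b ℕ.+ a ℕ.+ b ≡ 2 * (a ℕ.+ b)
    regroup = ℕ-Solver.solve-∀

  OQS⇒GOBA : OQS f → GOBA (arrayOf f)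
  OQS⇒GOBA oqs = values , zeros
    where
    unit : ∀ i → IsUnit (Rf f (suc i))
    unit i = normSq≡1⇒isUnit _ _ (oqs (suc i) λ ())

    ternary : ∀ a x → ¬ inH a x → Ternary (reRot a (Rf f x))
    ternary zero                   zero    ∉H = ⊥-elim (∉H (inj₁ refl , refl))
    ternary (suc zero)             zero    _  = subst (Ternary ∘ reRot (suc zero)) (sym Rf-zero) 0ᵗ
    ternary (suc (suc zero))       zero    ∉H = ⊥-elim (∉H (inj₂ refl , refl))
    ternary (suc (suc (suc zero))) zero    _  = subst (Ternary ∘ im) (sym Rf-zero) 0ᵗ
    ternary a                      (suc i) _  =
      ternary-reRot (isUnit⇒ternary-re (unit i)) (isUnit⇒ternary-im (unit i)) a

    values : ∀ a x → ¬ inH a x → Is0or±4 (Rexp (arrayOf f) a x)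
    values a x ∉H = subst Is0or±4 (sym (Rexp-arrayOf a x)) (ternary⇒4*-is0or±4 (ternary a x ∉H))

    one-zero-coordinate : ∀ x → δ₀ (re (Rf f x)) ℕ.+ δ₀ (im (Rf f x)) ≡ 1
    one-zero-coordinate zero    = subst (λ z → δ₀ (re z) ℕ.+ δ₀ (im z) ≡ 1) (sym Rf-zero) refl
    one-zero-coordinate (suc i) = isUnit⇒δ₀-re+δ₀-im≡1 (unit i)

    zeros : countE (Rexp (arrayOf f)) ≡ 2 * m
    zeros = trans countE-Rexp-arrayOf (cong (2 *_) (count-complementary m (re ∘ Rf f) (im ∘ Rf f) one-zero-coordinate))

GOBA⇒OQS : ∀ n (f : Fin (suc (2 * n)) → Quat) → GOBA (arrayOf f) → OQS f
GOBA⇒OQS n f (values , _) w w≢0 =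
  isUnit⇒normSq≡1 (ternary-odd⇒isUnit (ternary zero) (ternary (suc (suc (suc zero)))) odd)
  where
  ternary : ∀ a → Ternary (reRot a (Rf f w))
  ternary a = 4*-is0or±4⇒ternary _ (subst Is0or±4 (Rexp-arrayOf f a w) (values a w (w≢0 ∘ proj₂)))
  odd : Odd (re (Rf f w) + im (Rf f w))
  odd = subst Odd (sym (re+im-Rf f w)) (∑-odd-isSign-odd n _ (re+im-term-isSign f w))

theorem1 : (n : ℕ) (f : Fin (suc (2 * n)) → Quat) → OQS f ⇔ GOBA (arrayOf f)
theorem1 n f = mk⇔ (OQS⇒GOBA f) (GOBA⇒OQS n f)
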